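{- Let $G$ be a connected simple graph which is not isomorphic to $\mathcal{C}_n^+$ for any $n\ge3$ nor to the cone $C(A_3)$, and which does not contain an induced subgraph isomorphic to $\mathcal{C}_n^+$ for some $n\ge3$ or to $C(A_3)$. Then $G$ is either a tree, a cycle $\mathcal{C}_n$ with $n\ge3$, a complete graph $\mathcal{K}_n$ with $n\ge4$, or a complete bipartite graph $\mathcal{K}(p,q)$ with $p,q\ge2$.
   Context: A simple graph has no self-loops and at most one edge between two vertices. An induced subgraph of $G$ is obtained by removing a non-empty set of vertices of $G$ along with all edges attached to them. $\mathcal{C}_n$ is the cycle on $n$ vertices; $\mathcal{C}_n^+$ is the graph on $n+1$ vertices obtained from $\mathcal{C}_n$ by attaching one new vertex by a single edge to one vertex of the cycle; $C(A_3)$ is the graph on 4 vertices obtained from the path on 3 vertices by adding a vertex adjacent to all three; $\mathcal{K}_n$ is the complete graph on $n$ vertices; $\mathcal{K}(p,q)$ is the complete bipartite graph with parts of sizes $p$ and $q$. -}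

module Defs where

open import Data.Nat using (ℕ; zero; suc; _+_; _<_; _≡ᵇ_; _<ᵇ_)
open import Data.Bool using (Bool; true; false; _∧_; _∨_; not; _xor_)
open import Data.Fin using (Fin; toℕ; inject₁; fromℕ)
open import Data.Product using (Σ; _×_)
open import Relation.Binary.PropositionalEquality using (_≡_)
open import Relation.Binary.Construct.Closure.ReflexiveTransitive using (Star)
open import Relation.Nullary using (¬_)
open import Function.Bundles using (Bijection)
open import Function.Definitions using (Injective)

record Graph (n : ℕ) : Set where
  field
    adj    : Fin n → Fin n → Bool
    sym    : ∀ u v → adj u v ≡ adj v u
    irrefl : ∀ u → adj u u ≡ false
open Graph public

RawGraph : ℕ → Set
RawGraph m = Fin m → Fin m → Bool

Edge : ∀ {n} → Graph n → Fin n → Fin n → Set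
Edge G u v = adj G u v ≡ true

Connected : ∀ {n} → Graph n → Set
Connected G = ∀ u v → Star (Edge G) u v

record CycleIn {n} (G : Graph n) : Set where
  field
    m       : ℕ
    c       : Fin (3 + m) → Fin n
    c-inj   : Injective _≡_ _≡_ c
    c-step  : ∀ (i : Fin (2 + m)) → Edge G (c (inject₁ i)) (c (Fin.suc i))
    c-close : Edge G (c (fromℕ (2 + m))) (c Fin.zero)

Acyclic : ∀ {n} → Graph n → Set
Acyclic G = ¬ CycleIn G

IsTree : ∀ {n} → Graph n → Set
IsTree G = Connected G × Acyclic G

IsoTo : ∀ {n m} → Graph n → RawGraph m → Set
IsoTo {n} {m} G H =
  Σ (Bijection (≡-setoid (Fin n)) (≡-setoid (Fin m))) λ f →
    ∀ u v → adj G u v ≡ H (Bijection.to f u) (Bijection.to f v)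
  where open import Relation.Binary.PropositionalEquality using () renaming (setoid to ≡-setoid)

-- G contains an induced subgraph, obtained by removing a non-empty set of
-- vertices, isomorphic to H: an injective adjacency-preserving-and-reflecting
-- map from the m vertices of H into the n vertices of G with m < n.
HasProperInduced : ∀ {n m} → Graph n → RawGraph m → Set
HasProperInduced {n} {m} G H =
  m < n × Σ (Fin m → Fin n) λ f →
    Injective _≡_ _≡_ f × (∀ u v → H u v ≡ adj G (f u) (f v))

nextN : ℕ → ℕ → ℕ → Bool
nextN k a b = (suc a ≡ᵇ b) ∨ ((suc a ≡ᵇ k) ∧ (b ≡ᵇ 0))

cycN : ℕ → ℕ → ℕ → Bool
cycN k a b = (a <ᵇ k) ∧ ((b <ᵇ k) ∧ (nextN k a b ∨ nextN k b a))

cycleG : (k : ℕ) → RawGraph k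
cycleG k i j = cycN k (toℕ i) (toℕ j)

-- 𝒞_k⁺ on vertices 0..k: cycle on 0..k-1, vertex k pendant at vertex 0
cyclePlus : (k : ℕ) → RawGraph (suc k)
cyclePlus k i j =
  cycN k (toℕ i) (toℕ j)
  ∨ (((toℕ i ≡ᵇ k) ∧ (toℕ j ≡ᵇ 0)) ∨ ((toℕ j ≡ᵇ k) ∧ (toℕ i ≡ᵇ 0)))

-- C(A₃): path 0-1-2 plus vertex 3 adjacent to 0,1,2;
-- i.e. all distinct pairs except {0,2}
coneA3 : RawGraph 4
coneA3 i j =
  not (toℕ i ≡ᵇ toℕ j)
  ∧ not (((toℕ i ≡ᵇ 0) ∧ (toℕ j ≡ᵇ 2)) ∨ ((toℕ i ≡ᵇ 2) ∧ (toℕ j ≡ᵇ 0)))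

completeG : (k : ℕ) → RawGraph k
completeG k i j = not (toℕ i ≡ᵇ toℕ j)

bipartiteG : (p q : ℕ) → RawGraph (p + q)
bipartiteG p q i j = (toℕ i <ᵇ p) xor (toℕ j <ᵇ p)

{-# OPTIONS --safe #-}
module Submission where

-- Forbidding an induced 𝒞₃⁺ or C(A₃) forces every vertex that sees one corner of
-- a triangle to see all of it, so in a connected graph with a triangle every
-- vertex sees every other one and G is complete.  Without triangles, forbidding
-- an induced 𝒞₄⁺ makes the neighbourhoods of two adjacent corners of a 4-cycle
-- the two sides of a complete bipartite graph.  Without triangles and 4-cycles,
-- take a shortest cycle: a chord, or an outside vertex with two neighbours on it,
-- would give a shorter cycle, and an outside vertex with exactly one neighbour
-- would give an induced 𝒞ₙ⁺; so by connectedness G is that cycle.  Otherwise G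
-- is acyclic, i.e. a tree.

open import Defs
open import Data.Bool using (Bool; true; false; not; _xor_)
import Data.Bool.Properties as BoolP
open import Data.Empty using (⊥; ⊥-elim)
open import Data.Fin as F using (Fin; Fin′; toℕ; inject; fromℕ<; punchOut)
open import Data.Fin.Patterns using (0F; 1F; 2F; 3F; 4F)
import Data.Fin.Properties as FP
open import Data.Nat as ℕ using (ℕ; zero; suc; _+_; _*_; _≤_; _<_; z≤n; s≤s)
open import Data.Nat.DivMod
  using (_%_; _/_; m≡m%n+[m/n]*n; [m+kn]%n≡m%n; [m+n]%n≡m%n; m%n<n; n%n≡0; m<n⇒m%n≡m)
open import Data.Nat.Induction using (<-wellFounded)
import Data.Nat.Properties as ℕP
open import Data.Product using (Σ; _×_; _,_; proj₁; proj₂; ∃)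
open import Data.Sum as Sum using (_⊎_; inj₁; inj₂; [_,_]′)
open import Data.Sum.Properties using (swap-involutive)
open import Data.Vec.Functional using (_∷_; [])
open import Function using (_∘_; id; const)
open import Function.Bundles using (mk↔ₛ′)
open import Function.Definitions using (Injective)
open import Function.Properties.Inverse using (Inverse⇒Bijection)
open import Induction.WellFounded using (module All)
import Relation.Binary.Construct.On as On
open import Relation.Binary.Construct.Closure.ReflexiveTransitive using (Star; fold)
open import Relation.Binary.Definitions using (tri<; tri≈; tri>)
open import Relation.Binary.PropositionalEquality
  using (_≡_; _≢_; refl; trans; cong; cong₂; subst; subst₂; module ≡-Reasoning)
  renaming (sym to ≡-sym)
open import Relation.Nullary using (¬_; Dec; yes; no; does; contradiction; ¬?)
open import Relation.Nullary.Decidable as Dec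
  using (toWitness; _×-dec_; _⊎-dec_; _→-dec_; dec-true; dec-false)

≤⇒∃+ : ∀ {x y} → x ≤ y → ∃ λ d → x + d ≡ y
≤⇒∃+ x≤y = _ , ℕP.m+[n∸m]≡n x≤y

suc-% : ∀ x K → suc x % suc K ≡ suc (x % suc K) % suc K
suc-% x K = trans (cong (λ y → suc y % suc K) (m≡m%n+[m/n]*n x (suc K)))
                  ([m+kn]%n≡m%n (suc (x % suc K)) (x / suc K) (suc K))

distinct⇒2≤ : ∀ {p} {i j : Fin p} → i ≢ j → 2 ≤ p
distinct⇒2≤ {suc zero}    {0F} {0F} i≢j = ⊥-elim (i≢j refl)
distinct⇒2≤ {suc (suc p)} _             = s≤s (s≤s z≤n)

<⇒∃inject : ∀ {m} {i j : Fin m} → i F.< j → ∃ λ (v : Fin′ j) → inject v ≡ i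
<⇒∃inject i<j = fromℕ< i<j , FP.toℕ-injective (trans (FP.toℕ-inject (fromℕ< i<j)) (FP.toℕ-fromℕ< i<j))

distinct-below⇒injective : ∀ {m} {A : Set} (f : Fin m → A)
  → (∀ u (v : Fin′ u) → f (inject v) ≢ f u) → Injective _≡_ _≡_ f
distinct-below⇒injective f distinct {i} {j} fi≡fj with FP.<-cmp i j
... | tri≈ _ i≡j _ = i≡j
... | tri< i<j _ _ with <⇒∃inject i<j
...   | v , refl = ⊥-elim (distinct j v fi≡fj)
distinct-below⇒injective f distinct {i} {j} fi≡fj | tri> _ _ j<i with <⇒∃inject j<i
...   | v , refl = ⊥-elim (distinct i v (≡-sym fi≡fj))

injective⇒surjective : ∀ {n} (f : Fin n → Fin n) → Injective _≡_ _≡_ f → ∀ u → ∃ λ i → f i ≡ u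
injective⇒surjective {zero}  f f-inj ()
injective⇒surjective {suc n} f f-inj u with FP.any? (λ i → f i F.≟ u)
... | yes hit = hit
... | no miss = ⊥-elim (ℕP.1+n≰n (FP.injective⇒≤ punched-injective))
  where
  u≢f : ∀ i → u ≢ f i
  u≢f i u≡fi = miss (i , ≡-sym u≡fi)
  punched-injective : Injective _≡_ _≡_ (λ i → punchOut (u≢f i))
  punched-injective eq = f-inj (FP.punchOut-injective (u≢f _) (u≢f _) eq)

-- Without function extensionality the predicate must respect pointwise equality.
∃-function? : ∀ {k n} (Q : (Fin k → Fin n) → Set) → (∀ {f g} → (∀ i → f i ≡ g i) → Q f → Q g)
  → (∀ f → Dec (Q f)) → Dec (∃ Q)
∃-function? {zero} Q Q-resp Q? with Q? (λ ())
... | yes q = yes (_ , q)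
... | no ¬q = no λ (f , q) → ¬q (Q-resp (λ ()) q)
∃-function? {suc k} Q Q-resp Q? =
  Dec.map′ (λ (a , f , q) → a ∷ f , q) (λ (f , q) → f 0F , f ∘ F.suc , Q-resp head∷tail q)
    (FP.any? λ a → ∃-function? (Q ∘ (a ∷_)) (λ f≗g → Q-resp λ { 0F → refl ; (F.suc i) → f≗g i }) (Q? ∘ (a ∷_)))
  where
  head∷tail : ∀ {f : Fin (suc k) → _} i → f i ≡ (f 0F ∷ f ∘ F.suc) i
  head∷tail 0F        = refl
  head∷tail (F.suc i) = refl

-- Relational forms of the tables of Defs: does (cycleAdjacent? L x y) is cycN L x y
-- by definition, and does (cyclePlusAdjacent? L (toℕ i) (toℕ j)) is cyclePlus L i j.
IsNext : ℕ → ℕ → ℕ → Set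
IsNext L x y = suc x ≡ y ⊎ (suc x ≡ L × y ≡ 0)

isNext? : ∀ L x y → Dec (IsNext L x y)
isNext? L x y = (suc x ℕ.≟ y) ⊎-dec ((suc x ℕ.≟ L) ×-dec (y ℕ.≟ 0))

CycleAdjacent : ℕ → ℕ → ℕ → Set
CycleAdjacent L x y = x < L × y < L × (IsNext L x y ⊎ IsNext L y x)

cycleAdjacent? : ∀ L x y → Dec (CycleAdjacent L x y)
cycleAdjacent? L x y = (x ℕ.<? L) ×-dec (y ℕ.<? L) ×-dec (isNext? L x y ⊎-dec isNext? L y x)

CyclePlusAdjacent : ℕ → ℕ → ℕ → Set
CyclePlusAdjacent L a b = CycleAdjacent L a b ⊎ ((a ≡ L × b ≡ 0) ⊎ (b ≡ L × a ≡ 0))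

cyclePlusAdjacent? : ∀ L a b → Dec (CyclePlusAdjacent L a b)
cyclePlusAdjacent? L a b =
  cycleAdjacent? L a b ⊎-dec (((a ℕ.≟ L) ×-dec (b ℕ.≟ 0)) ⊎-dec ((b ℕ.≟ L) ×-dec (a ℕ.≟ 0)))

module _ {m : ℕ} (H : RawGraph m) where

  IsSimple : Set
  IsSimple = (∀ u v → H u v ≡ H v u) × (∀ u → H u u ≡ false)

  isSimple? : Dec IsSimple
  isSimple? = FP.all? (λ u → FP.all? λ v → H u v BoolP.≟ H v u) ×-dec FP.all? (λ u → H u u BoolP.≟ false)

cyclePlus3-simple : IsSimple (cyclePlus 3)
cyclePlus3-simple = toWitness {a? = isSimple? (cyclePlus 3)} _

cyclePlus4-simple : IsSimple (cyclePlus 4)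
cyclePlus4-simple = toWitness {a? = isSimple? (cyclePlus 4)} _

coneA3-simple : IsSimple coneA3
coneA3-simple = toWitness {a? = isSimple? coneA3} _

completeG3≡cycleG3 : ∀ u v → completeG 3 u v ≡ cycleG 3 u v
completeG3≡cycleG3 = toWitness {a? = FP.all? λ u → FP.all? λ v → completeG 3 u v BoolP.≟ cycleG 3 u v} _

module _ {n : ℕ} (G : Graph n) where

  edge-sym : ∀ {u v} → Edge G u v → Edge G v u
  edge-sym {u} {v} uv = trans (sym G v u) uv

  non-edge-sym : ∀ {u v} → adj G u v ≡ false → adj G v u ≡ false
  non-edge-sym {u} {v} ¬uv = trans (sym G v u) ¬uv

  edge⇒≢ : ∀ {u v} → Edge G u v → u ≢ v
  edge⇒≢ {u} uu refl with trans (≡-sym uu) (irrefl G u)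
  ... | ()

  edge? : ∀ u v → Dec (Edge G u v)
  edge? u v = adj G u v BoolP.≟ true

  does≡adj : ∀ {u v} {P : Set} (P? : Dec P) → (Edge G u v → P) → (P → Edge G u v) → does P? ≡ adj G u v
  does≡adj (yes p) _  from = ≡-sym (from p)
  does≡adj (no ¬p) to _    = ≡-sym (BoolP.¬-not (¬p ∘ to))

  walk-transport : (P : Fin n → Set) → (∀ {u v} → Edge G u v → P u → P v)
    → ∀ {u v} → Star (Edge G) u v → P u → P v
  walk-transport P step = fold (λ u v → P u → P v) (λ e k → k ∘ step e) id

  InducedCopy : ∀ {m} → RawGraph m → Set
  InducedCopy {m} H = Σ (Fin m → Fin n) λ f → Injective _≡_ _≡_ f × (∀ u v → H u v ≡ adj G (f u) (f v))

module _ {n m : ℕ} (G : Graph n) (H : RawGraph m) where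

  iso-from-inverse : (to : Fin n → Fin m) (from : Fin m → Fin n)
    → (∀ y → to (from y) ≡ y) → (∀ x → from (to x) ≡ x)
    → (∀ u v → adj G u v ≡ H (to u) (to v)) → IsoTo G H
  iso-from-inverse to from to∘from from∘to preserves =
    Inverse⇒Bijection (mk↔ₛ′ to from to∘from from∘to) , preserves

  IsoTo-resp : ∀ {H′ : RawGraph m} → (∀ u v → H u v ≡ H′ u v) → IsoTo G H → IsoTo G H′
  IsoTo-resp H≡H′ (f , f-adj) = f , λ u v → trans (f-adj u v) (H≡H′ _ _)

  surjective-copy⇒iso : ((f , _) : InducedCopy G H) → (∀ u → ∃ λ i → f i ≡ u) → IsoTo G H
  surjective-copy⇒iso (f , f-inj , f-adj) f-surj = iso-from-inverse g f g∘f f∘g g-adj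
    where
    g : Fin n → Fin m
    g u = proj₁ (f-surj u)
    f∘g : ∀ u → f (g u) ≡ u
    f∘g u = proj₂ (f-surj u)
    g∘f : ∀ i → g (f i) ≡ i
    g∘f i = f-inj (f∘g (f i))
    g-adj : ∀ u v → adj G u v ≡ H (g u) (g v)
    g-adj u v = trans (cong₂ (adj G) (≡-sym (f∘g u)) (≡-sym (f∘g v))) (≡-sym (f-adj (g u) (g v)))

  induced-copy⇒proper⊎iso : InducedCopy G H → HasProperInduced G H ⊎ IsoTo G H
  induced-copy⇒proper⊎iso copy@(f , f-inj , _) with ℕP.m≤n⇒m<n∨m≡n (FP.injective⇒≤ f-inj)
  ... | inj₁ m<n  = inj₁ (m<n , copy)
  ... | inj₂ refl = inj₂ (surjective-copy⇒iso copy (injective⇒surjective f f-inj))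

  no-induced-copy : ¬ HasProperInduced G H → ¬ IsoTo G H → ¬ InducedCopy G H
  no-induced-copy ¬proper ¬iso = [ ¬proper , ¬iso ]′ ∘ induced-copy⇒proper⊎iso

  -- For simple H it suffices to check pairs v < u, given by v : Fin′ u.
  lower-triangle⇒induced-copy : IsSimple H → (f : Fin m → Fin n)
    → (∀ u (v : Fin′ u) → f (inject v) ≢ f u)
    → (∀ u (v : Fin′ u) → H (inject v) u ≡ adj G (f (inject v)) (f u))
    → InducedCopy G H
  lower-triangle⇒induced-copy (H-sym , H-irrefl) f distinct agree =
    f , distinct-below⇒injective f distinct , f-adj
    where
    f-adj : ∀ u v → H u v ≡ adj G (f u) (f v)
    f-adj u v with FP.<-cmp u v
    ... | tri≈ _ refl _ = trans (H-irrefl u) (≡-sym (irrefl G (f u)))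
    ... | tri< u<v _ _ with <⇒∃inject u<v
    ...   | w , refl = agree v w
    f-adj u v | tri> _ _ v<u with <⇒∃inject v<u
    ...   | w , refl = trans (H-sym u (inject w)) (trans (agree u w) (sym G (f (inject w)) (f u)))

CyclePlusFree : ∀ {n} → Graph n → Set
CyclePlusFree G = ∀ k → 3 ≤ k → ¬ InducedCopy G (cyclePlus k)

ConeFree : ∀ {n} → Graph n → Set
ConeFree G = ¬ InducedCopy G coneA3

TriangleFree : ∀ {n} → Graph n → Set
TriangleFree G = ∀ {x y z} → Edge G x y → Edge G y z → Edge G z x → ⊥

SquareFree : ∀ {n} → Graph n → Set
SquareFree G = ∀ {a b c d} → Edge G a b → Edge G b c → Edge G c d → Edge G d a → a ≢ c → b ≢ d → ⊥

-- Triangles: complete graphs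

module _ {n : ℕ} (G : Graph n) where

  complete⇒iso : (∀ u v → u ≢ v → Edge G u v) → IsoTo G (completeG n)
  complete⇒iso complete = iso-from-inverse G (completeG n) id id (λ _ → refl) (λ _ → refl) agree
    where
    agree : ∀ u v → adj G u v ≡ completeG n u v
    agree u v with u F.≟ v
    ... | yes refl = trans (irrefl G u) (cong not (≡-sym (dec-true (toℕ u ℕ.≟ toℕ u) refl)))
    ... | no u≢v   = trans (complete u v u≢v)
                       (cong not (≡-sym (dec-false (toℕ u ℕ.≟ toℕ v) (u≢v ∘ FP.toℕ-injective))))

  triangle⇒3≤n : ∀ {a b c} → Edge G a b → Edge G b c → Edge G c a → 3 ≤ n
  triangle⇒3≤n {a} {b} {c} ab bc ca = FP.injective⇒≤ (distinct-below⇒injective (a ∷ b ∷ c ∷ []) distinct)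
    where
    distinct : ∀ u (v : Fin′ u) → (a ∷ b ∷ c ∷ []) (inject v) ≢ (a ∷ b ∷ c ∷ []) u
    distinct 1F 0F = edge⇒≢ G ab
    distinct 2F 0F = edge⇒≢ G (edge-sym G ca)
    distinct 2F 1F = edge⇒≢ G bc

  complete-iso⇒cycle-or-complete : 3 ≤ n → IsoTo G (completeG n)
    → (Σ ℕ λ k → 3 ≤ k × IsoTo G (cycleG k)) ⊎ (Σ ℕ λ k → 4 ≤ k × IsoTo G (completeG k))
  complete-iso⇒cycle-or-complete 3≤n Kₙ with ℕP.m≤n⇒m<n∨m≡n 3≤n
  ... | inj₁ 3<n  = inj₂ (n , 3<n , Kₙ)
  ... | inj₂ refl = inj₁ (3 , ℕP.≤-refl , IsoTo-resp G (completeG 3) completeG3≡cycleG3 Kₙ)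

module Triangles {n : ℕ} (G : Graph n) (no-C⁺ : CyclePlusFree G) (no-cone : ConeFree G) where

  private
    E = Edge G

  triangle-neighbour-adjacent : ∀ {a b c d} → E a b → E b c → E c a
    → d ≢ a → d ≢ b → d ≢ c → E d a → E d b
  triangle-neighbour-adjacent {a} {b} {c} {d} ab bc ca d≢a d≢b d≢c da
    with adj G d b in db | adj G d c in dc
  ... | true  | _     = refl
  ... | false | false = ⊥-elim (no-C⁺ 3 ℕP.≤-refl
      (lower-triangle⇒induced-copy G (cyclePlus 3) cyclePlus3-simple f distinct agree))
    where
    f : Fin 4 → Fin n
    f = a ∷ b ∷ c ∷ d ∷ []
    distinct : ∀ u (v : Fin′ u) → f (inject v) ≢ f u
    distinct 1F 0F = edge⇒≢ G ab
    distinct 2F 0F = edge⇒≢ G (edge-sym G ca)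
    distinct 2F 1F = edge⇒≢ G bc
    distinct 3F 0F = d≢a ∘ ≡-sym
    distinct 3F 1F = d≢b ∘ ≡-sym
    distinct 3F 2F = d≢c ∘ ≡-sym
    agree : ∀ u (v : Fin′ u) → cyclePlus 3 (inject v) u ≡ adj G (f (inject v)) (f u)
    agree 1F 0F = ≡-sym ab
    agree 2F 0F = ≡-sym (edge-sym G ca)
    agree 2F 1F = ≡-sym bc
    agree 3F 0F = ≡-sym (edge-sym G da)
    agree 3F 1F = ≡-sym (non-edge-sym G db)
    agree 3F 2F = ≡-sym (non-edge-sym G dc)
  ... | false | true = ⊥-elim (no-cone
      (lower-triangle⇒induced-copy G coneA3 coneA3-simple f distinct agree))
    where
    f : Fin 4 → Fin n
    f = d ∷ a ∷ b ∷ c ∷ []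
    distinct : ∀ u (v : Fin′ u) → f (inject v) ≢ f u
    distinct 1F 0F = d≢a
    distinct 2F 0F = d≢b
    distinct 2F 1F = edge⇒≢ G ab
    distinct 3F 0F = d≢c
    distinct 3F 1F = edge⇒≢ G (edge-sym G ca)
    distinct 3F 2F = edge⇒≢ G bc
    agree : ∀ u (v : Fin′ u) → coneA3 (inject v) u ≡ adj G (f (inject v)) (f u)
    agree 1F 0F = ≡-sym da
    agree 2F 0F = ≡-sym db
    agree 2F 1F = ≡-sym ab
    agree 3F 0F = ≡-sym dc
    agree 3F 1F = ≡-sym (edge-sym G ca)
    agree 3F 2F = ≡-sym bc

  EdgesInTriangles : Fin n → Set
  EdgesInTriangles x = ∀ {y} → E x y → ∃ λ z → E x z × E y z

  triangle⇒edges-in-triangles : ∀ {a b c} → E a b → E b c → E c a → EdgesInTriangles a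
  triangle⇒edges-in-triangles {a} {b} {c} ab bc ca {y} ay with y F.≟ b | y F.≟ c
  ... | yes refl | _        = c , edge-sym G ca , bc
  ... | no _     | yes refl = b , ab , edge-sym G bc
  ... | no y≢b   | no y≢c   =
    b , ab , triangle-neighbour-adjacent ab bc ca (edge⇒≢ G ay ∘ ≡-sym) y≢b y≢c (edge-sym G ay)

  edges-in-triangles-step : ∀ {x y} → E x y → EdgesInTriangles x → EdgesInTriangles y
  edges-in-triangles-step xy x-ok with x-ok xy
  ... | z , xz , yz = triangle⇒edges-in-triangles (edge-sym G xy) xz (edge-sym G yz)

  connected-triangle⇒complete : Connected G → ∀ {a b c} → E a b → E b c → E c a
    → ∀ u v → u ≢ v → E u v
  connected-triangle⇒complete conn ab bc ca u v u≢v
    with walk-transport G (λ w → u ≡ w ⊎ E u w) extend (conn u v) (inj₁ refl)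
    where
    in-triangles : ∀ x → EdgesInTriangles x
    in-triangles x = walk-transport G EdgesInTriangles edges-in-triangles-step (conn _ x)
                       (triangle⇒edges-in-triangles ab bc ca)
    -- the edge u v lies in a triangle, all of which w sees since it sees v
    extend : ∀ {v w} → E v w → u ≡ v ⊎ E u v → u ≡ w ⊎ E u w
    extend vw (inj₁ refl) = inj₂ vw
    extend {v} {w} vw (inj₂ uv) with w F.≟ u | in-triangles v (edge-sym G uv)
    ... | yes refl | _ = inj₁ refl
    ... | no w≢u | z , vz , uz with w F.≟ z
    ...   | yes refl = inj₂ uz
    ...   | no w≢z   = inj₂ (edge-sym G (triangle-neighbour-adjacent (edge-sym G uv) uz (edge-sym G vz)
                         (edge⇒≢ G vw ∘ ≡-sym) w≢u w≢z (edge-sym G vw)))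
  ... | inj₁ u≡v = ⊥-elim (u≢v u≡v)
  ... | inj₂ uv  = uv

  connected-triangle⇒cycle-or-complete : Connected G → ∀ {a b c} → E a b → E b c → E c a
    → (Σ ℕ λ k → 3 ≤ k × IsoTo G (cycleG k)) ⊎ (Σ ℕ λ k → 4 ≤ k × IsoTo G (completeG k))
  connected-triangle⇒cycle-or-complete conn ab bc ca = complete-iso⇒cycle-or-complete G
    (triangle⇒3≤n G ab bc ca) (complete⇒iso G (connected-triangle⇒complete conn ab bc ca))

-- Squares: complete bipartite graphs

isLeft : ∀ {A B : Set} → A ⊎ B → Bool
isLeft = [ const true , const false ]′

record Split {n : ℕ} (s : Fin n → Bool) : Set where
  field
    p q     : ℕ
    to      : Fin n → Fin p ⊎ Fin q
    from    : Fin p ⊎ Fin q → Fin n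
    to∘from : ∀ y → to (from y) ≡ y
    from∘to : ∀ x → from (to x) ≡ x
    side    : ∀ x → isLeft (to x) ≡ s x

module _ {n : ℕ} {s : Fin n → Bool} (S : Split s) where
  open Split S

  Split-resp : ∀ {s′} → (∀ x → s x ≡ s′ x) → Split s′
  Split-resp s≡s′ = record { Split S ; side = λ x → trans (side x) (s≡s′ x) }

  Split-swap : Split (not ∘ s)
  Split-swap = record
    { p = q ; q = p ; to = Sum.swap ∘ to ; from = from ∘ Sum.swap
    ; to∘from = λ y → trans (cong Sum.swap (to∘from (Sum.swap y))) (swap-involutive y)
    ; from∘to = λ x → trans (cong from (swap-involutive (to x))) (from∘to x)
    ; side = λ x → trans (isLeft-swap (to x)) (cong not (side x)) }
    where
    isLeft-swap : ∀ {A B : Set} (w : A ⊎ B) → isLeft (Sum.swap w) ≡ not (isLeft w)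
    isLeft-swap (inj₁ _) = refl
    isLeft-swap (inj₂ _) = refl

  Split-cons-true : Split (true ∷ s)
  Split-cons-true = record
    { p = suc p ; q = q ; to = to′ ; from = from′ ; to∘from = to∘from′ ; from∘to = from∘to′ ; side = side′ }
    where
    to′ : Fin (suc n) → Fin (suc p) ⊎ Fin q
    to′ 0F        = inj₁ 0F
    to′ (F.suc x) = Sum.map₁ F.suc (to x)
    from′ : Fin (suc p) ⊎ Fin q → Fin (suc n)
    from′ (inj₁ 0F)        = 0F
    from′ (inj₁ (F.suc y)) = F.suc (from (inj₁ y))
    from′ (inj₂ y)         = F.suc (from (inj₂ y))
    to∘from′ : ∀ y → to′ (from′ y) ≡ y
    to∘from′ (inj₁ 0F)        = refl
    to∘from′ (inj₁ (F.suc y)) = cong (Sum.map₁ F.suc) (to∘from (inj₁ y))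
    to∘from′ (inj₂ y)         = cong (Sum.map₁ F.suc) (to∘from (inj₂ y))
    from∘to′ : ∀ x → from′ (to′ x) ≡ x
    from∘to′ 0F        = refl
    from∘to′ (F.suc x) with to x in eq
    ... | inj₁ y = cong F.suc (trans (cong from (≡-sym eq)) (from∘to x))
    ... | inj₂ y = cong F.suc (trans (cong from (≡-sym eq)) (from∘to x))
    side′ : ∀ x → isLeft (to′ x) ≡ (true ∷ s) x
    side′ 0F        = refl
    side′ (F.suc x) with to x in eq
    ... | inj₁ y = trans (cong isLeft (≡-sym eq)) (side x)
    ... | inj₂ y = trans (cong isLeft (≡-sym eq)) (side x)

Split-cons : ∀ {n} {s : Fin n → Bool} (b : Bool) → Split s → Split (b ∷ s)
Split-cons true  S = Split-cons-true S
Split-cons false S = Split-resp (Split-swap (Split-cons-true (Split-swap S))) λ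
  { 0F → refl ; (F.suc x) → BoolP.not-involutive _ }

split : ∀ {n} (s : Fin n → Bool) → Split s
split {zero}  s = record
  { p = 0 ; q = 0 ; to = λ () ; from = [ (λ ()) , (λ ()) ]′
  ; to∘from = λ { (inj₁ ()) ; (inj₂ ()) } ; from∘to = λ () ; side = λ () }
split {suc n} s = Split-resp (Split-cons (s 0F) (split (s ∘ F.suc))) λ
  { 0F → refl ; (F.suc x) → refl }

module _ {n : ℕ} {s : Fin n → Bool} (S : Split s) where
  open Split S

  to-injective : Injective _≡_ _≡_ to
  to-injective {x} {y} tx≡ty = trans (≡-sym (from∘to x)) (trans (cong from tx≡ty) (from∘to y))

  distinct-left⇒2≤p : ∀ {x y} → s x ≡ true → s y ≡ true → x ≢ y → 2 ≤ p
  distinct-left⇒2≤p {x} {y} sx sy x≢y with to x in tx | to y in ty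
  ... | inj₂ _ | _      = contradiction (trans (≡-sym (cong isLeft tx)) (trans (side x) sx)) λ ()
  ... | inj₁ _ | inj₂ _ = contradiction (trans (≡-sym (cong isLeft ty)) (trans (side y) sy)) λ ()
  ... | inj₁ i | inj₁ j = distinct⇒2≤ {i = i} {j} λ { refl → x≢y (to-injective (trans tx (≡-sym ty))) }

join-isLeft : ∀ p q (w : Fin p ⊎ Fin q) → (toℕ (F.join p q w) ℕ.<ᵇ p) ≡ isLeft w
join-isLeft p q (inj₁ i) = dec-true (toℕ (i F.↑ˡ q) ℕ.<? p) (subst (_< p) (≡-sym (FP.toℕ-↑ˡ i q)) (FP.toℕ<n i))
join-isLeft p q (inj₂ j) = dec-false (toℕ (p F.↑ʳ j) ℕ.<? p)
  (ℕP.≤⇒≯ (subst (p ≤_) (≡-sym (FP.toℕ-↑ʳ p j)) (ℕP.m≤m+n p (toℕ j))))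

xor-adjacency⇒bipartite : ∀ {n} (G : Graph n) {s : Fin n → Bool} → (∀ u v → adj G u v ≡ s u xor s v)
  → (S : Split s) → IsoTo G (bipartiteG (Split.p S) (Split.q S))
xor-adjacency⇒bipartite G {s} adj≡xor S =
  iso-from-inverse G (bipartiteG p q) (F.join p q ∘ to) (from ∘ F.splitAt p)
    (λ y → trans (cong (F.join p q) (to∘from (F.splitAt p y))) (FP.join-splitAt p q y))
    (λ x → trans (cong from (FP.splitAt-join p q (to x))) (from∘to x))
    λ u v → trans (adj≡xor u v) (≡-sym (cong₂ _xor_ (side′ u) (side′ v)))
  where
  open Split S
  side′ : ∀ x → (toℕ (F.join p q (to x)) ℕ.<ᵇ p) ≡ s x
  side′ x = trans (join-isLeft p q (to x)) (side x)

module Squares {n : ℕ} (G : Graph n) (no-C⁺ : CyclePlusFree G) (no-triangle : TriangleFree G) where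

  private
    E = Edge G

  common-neighbour⇒non-adjacent : ∀ {x y z} → E x y → E y z → adj G x z ≡ false
  common-neighbour⇒non-adjacent xy yz = BoolP.¬-not λ xz → no-triangle xy yz (edge-sym G xz)

  square-neighbour-adjacent : ∀ {p q r s e} → E p q → E q r → E r s → E s p → p ≢ r → q ≢ s
    → e ≢ p → e ≢ q → e ≢ r → e ≢ s → E e p → E e r
  square-neighbour-adjacent {p} {q} {r} {s} {e} pq qr rs sp p≢r q≢s e≢p e≢q e≢r e≢s ep
    with adj G e r in er
  ... | true  = refl
  ... | false = ⊥-elim (no-C⁺ 4 (s≤s (s≤s (s≤s z≤n)))
                  (lower-triangle⇒induced-copy G (cyclePlus 4) cyclePlus4-simple f distinct agree))
    where
    f : Fin 5 → Fin n
    f = p ∷ q ∷ r ∷ s ∷ e ∷ []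
    distinct : ∀ u (v : Fin′ u) → f (inject v) ≢ f u
    distinct 1F 0F = edge⇒≢ G pq
    distinct 2F 0F = p≢r
    distinct 2F 1F = edge⇒≢ G qr
    distinct 3F 0F = edge⇒≢ G (edge-sym G sp)
    distinct 3F 1F = q≢s
    distinct 3F 2F = edge⇒≢ G rs
    distinct 4F 0F = e≢p ∘ ≡-sym
    distinct 4F 1F = e≢q ∘ ≡-sym
    distinct 4F 2F = e≢r ∘ ≡-sym
    distinct 4F 3F = e≢s ∘ ≡-sym
    agree : ∀ u (v : Fin′ u) → cyclePlus 4 (inject v) u ≡ adj G (f (inject v)) (f u)
    agree 1F 0F = ≡-sym pq
    agree 2F 0F = ≡-sym (common-neighbour⇒non-adjacent pq qr)
    agree 2F 1F = ≡-sym qr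
    agree 3F 0F = ≡-sym (edge-sym G sp)
    agree 3F 1F = ≡-sym (common-neighbour⇒non-adjacent qr rs)
    agree 3F 2F = ≡-sym rs
    agree 4F 0F = ≡-sym (edge-sym G ep)
    agree 4F 1F = ≡-sym (common-neighbour⇒non-adjacent (edge-sym G pq) (edge-sym G ep))
    agree 4F 2F = ≡-sym (non-edge-sym G er)
    agree 4F 3F = ≡-sym (common-neighbour⇒non-adjacent sp (edge-sym G ep))

  module Square {a b c d} (ab : E a b) (bc : E b c) (cd : E c d) (da : E d a)
                (a≢c : a ≢ c) (b≢d : b ≢ d) where

    b-neighbour⇒d-neighbour : ∀ {x} → E x b → x ≢ a → E x d
    b-neighbour⇒d-neighbour {x} xb x≢a with x F.≟ c
    ... | yes refl = cd
    ... | no x≢c   = square-neighbour-adjacent bc cd da ab b≢d (a≢c ∘ ≡-sym)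
                       (edge⇒≢ G xb) x≢c x≢d x≢a xb
      where
      x≢d : x ≢ d
      x≢d refl = no-triangle ab (edge-sym G xb) da

    b-neighbour-neighbour⇒a-neighbour : ∀ {x y} → E x b → E x y → E y a
    b-neighbour-neighbour⇒a-neighbour {x} {y} xb xy with x F.≟ a
    ... | yes refl = edge-sym G xy
    ... | no x≢a with y F.≟ b | y F.≟ d | y F.≟ a
    ...   | yes refl | _        | _        = edge-sym G ab
    ...   | no _     | yes refl | _        = da
    ...   | no _     | no _     | yes refl = ⊥-elim (no-triangle xy ab (edge-sym G xb))
    ...   | no y≢b   | no y≢d   | no y≢a   =
      square-neighbour-adjacent (b-neighbour⇒d-neighbour xb x≢a) da ab (edge-sym G xb) x≢a
        (b≢d ∘ ≡-sym) (edge⇒≢ G xy ∘ ≡-sym) y≢d y≢a y≢b (edge-sym G xy)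

    b-neighbour-adjacent-a-neighbour : ∀ {x y} → E x b → E y a → E x y
    b-neighbour-adjacent-a-neighbour {x} {y} xb ya with x F.≟ a | y F.≟ b
    ... | yes refl | _        = edge-sym G ya
    ... | no _     | yes refl = xb
    ... | no x≢a   | no y≢b with y F.≟ x | y F.≟ d
    ...   | yes refl | _        = ⊥-elim (no-triangle ya ab (edge-sym G xb))
    ...   | no _     | yes refl = b-neighbour⇒d-neighbour xb x≢a
    ...   | no y≢x   | no y≢d   = edge-sym G (square-neighbour-adjacent ab (edge-sym G xb)
        (b-neighbour⇒d-neighbour xb x≢a) da (x≢a ∘ ≡-sym) b≢d (edge⇒≢ G ya) y≢b y≢x y≢d ya)

  connected-square⇒complete-bipartite : Connected G → ∀ {a b c d}
    → E a b → E b c → E c d → E d a → a ≢ c → b ≢ d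
    → Σ ℕ λ p → Σ ℕ λ q → 2 ≤ p × 2 ≤ q × IsoTo G (bipartiteG p q)
  connected-square⇒complete-bipartite conn {a} {b} {c} {d} ab bc cd da a≢c b≢d =
    p , q , distinct-left⇒2≤p S ab (edge-sym G bc) a≢c , distinct-left⇒2≤p (Split-swap S) b-side d-side b≢d ,
    xor-adjacency⇒bipartite G adj≡xor S
    where
    module S₁ = Square ab bc cd da a≢c b≢d
    module S₂ = Square (edge-sym G ab) (edge-sym G da) (edge-sym G cd) (edge-sym G bc) b≢d a≢c

    sees-b-or-a : ∀ x → E x b ⊎ E x a
    sees-b-or-a x = walk-transport G (λ x → E x b ⊎ E x a) step (conn a x) (inj₁ ab)
      where
      step : ∀ {x y} → E x y → E x b ⊎ E x a → E y b ⊎ E y a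
      step xy (inj₁ xb) = inj₂ (S₁.b-neighbour-neighbour⇒a-neighbour xb xy)
      step xy (inj₂ xa) = inj₁ (S₂.b-neighbour-neighbour⇒a-neighbour xa xy)

    sees-a : ∀ {x} → adj G x b ≡ false → E x a
    sees-a {x} xb with sees-b-or-a x
    ... | inj₁ xb′ = contradiction (trans (≡-sym xb) xb′) λ ()
    ... | inj₂ xa  = xa

    adj≡xor : ∀ u v → adj G u v ≡ adj G u b xor adj G v b
    adj≡xor u v with adj G u b in ub | adj G v b in vb
    ... | true  | true  = common-neighbour⇒non-adjacent ub (edge-sym G vb)
    ... | true  | false = S₁.b-neighbour-adjacent-a-neighbour ub (sees-a vb)
    ... | false | true  = edge-sym G (S₁.b-neighbour-adjacent-a-neighbour vb (sees-a ub))
    ... | false | false = common-neighbour⇒non-adjacent (sees-a ub) (edge-sym G (sees-a vb))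

    S = split (λ x → adj G x b)
    open Split S using (p; q)

    b-side : not (adj G b b) ≡ true
    b-side = cong not (irrefl G b)
    d-side : not (adj G d b) ≡ true
    d-side = cong not (common-neighbour⇒non-adjacent da ab)

-- Cycles

module Cycles {n : ℕ} (G : Graph n) where

  private
    E = Edge G

  -- A cycle of length 3 + k, unrolled into a (3 + k)-periodic walk that is
  -- injective on one period; positions are read modulo the length.
  record Cycle : Set where
    field
      k         : ℕ
      at        : ℕ → Fin n
      periodic  : ∀ x → at (x + (3 + k)) ≡ at x
      step      : ∀ x → E (at x) (at (suc x))
      injective : ∀ {x y} → x < 3 + k → y < 3 + k → at x ≡ at y → x ≡ y

  cycle-from-path : ∀ k (p : ℕ → Fin n)
    → (∀ {x} → suc x < 3 + k → E (p x) (p (suc x))) → E (p (2 + k)) (p 0)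
    → (∀ {x y} → x < 3 + k → y < 3 + k → p x ≡ p y → x ≡ y) → Cycle
  cycle-from-path k p path-step closing p-injective = record
    { k = k
    ; at = λ x → p (x % L)
    ; periodic = λ x → cong p ([m+n]%n≡m%n x L)
    ; step = step
    ; injective = λ {x} {y} x<L y<L px≡py → p-injective x<L y<L
        (subst₂ (λ x′ y′ → p x′ ≡ p y′) (m<n⇒m%n≡m x<L) (m<n⇒m%n≡m y<L) px≡py)
    }
    where
    L = 3 + k
    step : ∀ x → E (p (x % L)) (p (suc x % L))
    step x with ℕP.m≤n⇒m<n∨m≡n (m%n<n x L)
    ... | inj₁ 1+x%L<L = subst (E (p (x % L)) ∘ p)
          (≡-sym (trans (suc-% x (2 + k)) (m<n⇒m%n≡m 1+x%L<L))) (path-step 1+x%L<L)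
    ... | inj₂ 1+x%L≡L = subst₂ (λ y z → E (p y) (p z))
          (≡-sym (ℕP.suc-injective 1+x%L≡L))
          (≡-sym (trans (suc-% x (2 + k)) (trans (cong (_% L) 1+x%L≡L) (n%n≡0 L)))) closing

  module _ (C : Cycle) where
    open Cycle C

    private
      L = 3 + k

    at-L : at L ≡ at 0
    at-L = periodic 0

    at-+* : ∀ x q → at (x + q * L) ≡ at x
    at-+* x zero    = cong at (ℕP.+-identityʳ x)
    at-+* x (suc q) = begin
      at (x + (L + q * L)) ≡⟨ cong at (ℕP.+-comm x (L + q * L)) ⟩
      at (L + q * L + x)   ≡⟨ cong at (ℕP.+-assoc L (q * L) x) ⟩
      at (L + (q * L + x)) ≡⟨ cong at (ℕP.+-comm L (q * L + x)) ⟩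
      at (q * L + x + L)   ≡⟨ periodic (q * L + x) ⟩
      at (q * L + x)       ≡⟨ cong at (ℕP.+-comm (q * L) x) ⟩
      at (x + q * L)       ≡⟨ at-+* x q ⟩
      at x                 ∎
      where open ≡-Reasoning

    at-% : ∀ x → at x ≡ at (x % L)
    at-% x = trans (cong at (m≡m%n+[m/n]*n x L)) (at-+* (x % L) (x / L))

    window-injective : ∀ r {x y} → x < L → y < L → at (x + r) ≡ at (y + r) → x ≡ y
    window-injective zero {x} {y} x<L y<L eq =
      injective x<L y<L (subst₂ (λ x′ y′ → at x′ ≡ at y′) (ℕP.+-identityʳ x) (ℕP.+-identityʳ y) eq)
    window-injective (suc r) {x} {y} x<L y<L eq =
      unshift (ℕP.m≤n⇒m<n∨m≡n x<L) (ℕP.m≤n⇒m<n∨m≡n y<L)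
      where
      eq′ : at (suc x + r) ≡ at (suc y + r)
      eq′ = subst₂ (λ x′ y′ → at x′ ≡ at y′) (ℕP.+-suc x r) (ℕP.+-suc y r) eq
      wrap : at (L + r) ≡ at (0 + r)
      wrap = trans (cong at (ℕP.+-comm L r)) (periodic r)
      unshift : suc x < L ⊎ suc x ≡ L → suc y < L ⊎ suc y ≡ L → x ≡ y
      unshift (inj₁ 1+x<L) (inj₁ 1+y<L) = ℕP.suc-injective (window-injective r 1+x<L 1+y<L eq′)
      unshift (inj₁ 1+x<L) (inj₂ refl)  =
        contradiction (window-injective r 1+x<L (s≤s z≤n) (trans eq′ wrap)) λ ()
      unshift (inj₂ refl)  (inj₁ 1+y<L) =
        contradiction (window-injective r (s≤s z≤n) 1+y<L (trans (≡-sym wrap) eq′)) λ ()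
      unshift (inj₂ 1+x≡L) (inj₂ 1+y≡L) = ℕP.suc-injective (trans 1+x≡L (≡-sym 1+y≡L))

    rotate : ℕ → Cycle
    rotate r = record
      { k = k
      ; at = λ x → at (x + r)
      ; periodic = λ x → trans (cong at (shuffle x)) (periodic (x + r))
      ; step = λ x → step (x + r)
      ; injective = window-injective r
      }
      where
      shuffle : ∀ x → x + L + r ≡ x + r + L
      shuffle x = trans (ℕP.+-assoc x L r) (trans (cong (x +_) (ℕP.+-comm L r)) (≡-sym (ℕP.+-assoc x r L)))

    next⇒edge : ∀ {x y} → IsNext L x y → E (at x) (at y)
    next⇒edge {x} (inj₁ refl)            = step x
    next⇒edge {x} (inj₂ (1+x≡L , refl)) = subst (E (at x)) (trans (cong at 1+x≡L) at-L) (step x)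

    cycle-adjacent⇒edge : ∀ {x y} → CycleAdjacent L x y → E (at x) (at y)
    cycle-adjacent⇒edge (_ , _ , inj₁ x→y) = next⇒edge x→y
    cycle-adjacent⇒edge (_ , _ , inj₂ y→x) = edge-sym G (next⇒edge y→x)

    arc : ∀ e → 2 + e < L → E (at (2 + e)) (at 0) → Cycle
    arc e 2+e<L closing = cycle-from-path e at (λ {x} _ → step x) closing
      (λ x<3+e y<3+e → injective (ℕP.<-≤-trans x<3+e 2+e<L) (ℕP.<-≤-trans y<3+e 2+e<L))

    Chord : Set
    Chord = Σ ℕ λ x → x < L × Σ ℕ λ y → y < L × E (at x) (at y) × ¬ (IsNext L x y ⊎ IsNext L y x)

    chord? : Dec Chord
    chord? = ℕP.anyUpTo? (λ x → ℕP.anyUpTo? (λ y → edge? G (at x) (at y) ×-dec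
               ¬? (isNext? L x y ⊎-dec isNext? L y x)) L) L

    Chordless : Set
    Chordless = ∀ {x y} → x < L → y < L → E (at x) (at y) → IsNext L x y ⊎ IsNext L y x

    ¬chord⇒chordless : ¬ Chord → Chordless
    ¬chord⇒chordless no-chord {x} {y} x<L y<L xy with isNext? L x y ⊎-dec isNext? L y x
    ... | yes adjacent = adjacent
    ... | no ¬adjacent = ⊥-elim (no-chord (x , x<L , y , y<L , xy , ¬adjacent))

    chordless⇒cycle-induced : Chordless → ∀ {x y} → x < L → y < L → cycN L x y ≡ adj G (at x) (at y)
    chordless⇒cycle-induced chordless {x} {y} x<L y<L =
      does≡adj G (cycleAdjacent? L x y) (λ xy → x<L , y<L , chordless x<L y<L xy) cycle-adjacent⇒edge

  length : Cycle → ℕ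
  length C = 3 + Cycle.k C

  Shorter : Cycle → Set
  Shorter C = Σ Cycle λ C′ → Cycle.k C′ < Cycle.k C

  module _ (C : Cycle) where
    open Cycle C

    private
      L = 3 + k

    ordered-chord⇒shorter : ∀ x d → x + d < L → E (at x) (at (x + d))
      → ¬ (IsNext L x (x + d) ⊎ IsNext L (x + d) x) → Shorter C
    ordered-chord⇒shorter x zero _ xx _ = ⊥-elim (edge⇒≢ G xx (cong at (≡-sym (ℕP.+-identityʳ x))))
    ordered-chord⇒shorter x 1 _ _ ¬adjacent = ⊥-elim (¬adjacent (inj₁ (inj₁ (ℕP.+-comm 1 x))))
    ordered-chord⇒shorter x (suc (suc e)) x+d<L xy ¬adjacent =
      arc (rotate C x) e (ℕP.<-trans (ℕP.n<1+n (2 + e)) 3+e<L) closing , ℕP.+-cancelˡ-< 3 e k 3+e<L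
      where
      closing : E (at (2 + e + x)) (at (0 + x))
      closing = subst (λ z → E (at z) (at x)) (ℕP.+-comm x (2 + e)) (edge-sym G xy)
      -- 3 + e ≡ L would force x ≡ 0, making the chord the closing edge of the cycle
      3+e<L : 3 + e < L
      3+e<L = ℕP.≤∧≢⇒< (ℕP.≤-<-trans (ℕP.m≤n+m (2 + e) x) x+d<L) λ 3+e≡L →
        let x≡0 = ℕP.n≤0⇒n≡0 (ℕP.+-cancelʳ-≤ (2 + e) x 0 (ℕ.s≤s⁻¹ (subst (x + (2 + e) <_) (≡-sym 3+e≡L) x+d<L)))
        in ¬adjacent (inj₂ (inj₂ (trans (cong (λ z → suc (z + (2 + e))) x≡0) 3+e≡L , x≡0)))

    chord⇒shorter : Chord C → Shorter C
    chord⇒shorter (x , x<L , y , y<L , xy , ¬adjacent) with ℕP.<-cmp x y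
    ... | tri≈ _ refl _ = ⊥-elim (edge⇒≢ G xy refl)
    ... | tri< x<y _ _ with ≤⇒∃+ (ℕP.<⇒≤ x<y)
    ...   | d , refl = ordered-chord⇒shorter x d y<L xy ¬adjacent
    chord⇒shorter (x , x<L , y , y<L , xy , ¬adjacent) | tri> _ _ y<x with ≤⇒∃+ (ℕP.<⇒≤ y<x)
    ...   | d , refl = ordered-chord⇒shorter y d x<L (edge-sym G xy) (¬adjacent ∘ Sum.swap)

    OnCycle : Fin n → Set
    OnCycle v = Σ ℕ λ x → x < L × at x ≡ v

    onCycle? : ∀ v → Dec (OnCycle v)
    onCycle? v = ℕP.anyUpTo? (λ x → at x F.≟ v) L

    Off : Fin n → Set
    Off v = ∀ x → at x ≢ v

    ¬onCycle⇒off : ∀ {v} → ¬ OnCycle v → Off v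
    ¬onCycle⇒off ¬on x eq = ¬on (x % L , m%n<n x L , trans (≡-sym (at-% C x)) eq)

    Attached : Set
    Attached = Σ (Fin n) λ v → ¬ OnCycle v × Σ ℕ λ x → x < L × E v (at x)

    attached? : Dec Attached
    attached? = FP.any? λ v → ¬? (onCycle? v) ×-dec ℕP.anyUpTo? (λ x → edge? G v (at x)) L

    unattached⇒spanning : Connected G → ¬ Attached → ∀ v → OnCycle v
    unattached⇒spanning conn ¬attached v =
      walk-transport G OnCycle extend (conn (at 0) v) (0 , s≤s z≤n , refl)
      where
      extend : ∀ {u w} → E u w → OnCycle u → OnCycle w
      extend {w = w} uw (x , x<L , refl) with onCycle? w
      ... | yes on = on
      ... | no ¬on = ⊥-elim (¬attached (w , ¬on , x , x<L , edge-sym G uw))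

    shortcut : ∀ {v} → Off v → ∀ e → suc e < L → E v (at 0) → E v (at (suc e)) → Cycle
    shortcut {v} off e 1+e<L v0 v1+e = cycle-from-path e p path-step (edge-sym G v1+e) p-injective
      where
      p : ℕ → Fin n
      p zero    = v
      p (suc x) = at x
      path-step : ∀ {x} → suc x < 3 + e → E (p x) (p (suc x))
      path-step {zero}  _ = v0
      path-step {suc x} _ = step x
      p-injective : ∀ {x y} → x < 3 + e → y < 3 + e → p x ≡ p y → x ≡ y
      p-injective {zero}  {zero}  _ _ _ = refl
      p-injective {zero}  {suc y} _ _ eq = ⊥-elim (off y (≡-sym eq))
      p-injective {suc x} {zero}  _ _ eq = ⊥-elim (off x eq)
      p-injective {suc x} {suc y} (s≤s x<2+e) (s≤s y<2+e) eq =
        cong suc (injective (ℕP.<-≤-trans x<2+e 1+e<L) (ℕP.<-≤-trans y<2+e 1+e<L) eq)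

  module _ (C : Cycle) where
    open Cycle C

    private
      L = 3 + k

    -- v with neighbours at x and y = x + 1 + e closes a cycle through either arc
    -- between them; for k ≥ 2 one of the two is shorter than C.
    ordered-neighbours⇒shorter : 2 ≤ k → ∀ {v} → Off C v → ∀ x e → x + suc e < L
      → E v (at x) → E v (at (x + suc e)) → Shorter C
    ordered-neighbours⇒shorter 2≤k {v} off x e y<L vx vy = by-arc (e ℕ.<? k) (≤⇒∃+ 1+e<L)
      where
      1+e<L : suc e < L
      1+e<L = ℕP.≤-<-trans (ℕP.m≤n+m (suc e) x) y<L
      by-arc : Dec (e < k) → (∃ λ t → 2 + e + t ≡ L) → Shorter C
      by-arc (yes e<k) _ = shortcut (rotate C x) (λ z → off (z + x)) e 1+e<L vx
                             (subst (E v ∘ at) (ℕP.+-comm x (suc e)) vy) , e<k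
      by-arc (no e≮k) (t , 2+e+t≡L) =
        shortcut (rotate C (x + suc e)) (λ z → off (z + (x + suc e))) t 1+t<L vy
          (subst (E v) (≡-sym wraps) vx) , t<k
        where
        1+t<L : suc t < L
        1+t<L = subst (suc t <_) 2+e+t≡L (s≤s (s≤s (ℕP.m≤n+m t e)))
        t<k : t < k
        t<k = ℕP.<-≤-trans (s≤s t≤1) 2≤k
          where
          open ℕP.≤-Reasoning
          t≤1 : t ≤ 1
          t≤1 = ℕP.+-cancelˡ-≤ e t 1 (begin
            e + t ≡⟨ ℕP.suc-injective (ℕP.suc-injective 2+e+t≡L) ⟩
            suc k ≤⟨ s≤s (ℕP.≮⇒≥ e≮k) ⟩
            suc e ≡⟨ ℕP.+-comm 1 e ⟩
            e + 1 ∎)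
        wraps : at (suc t + (x + suc e)) ≡ at x
        wraps = begin
          at (suc t + (x + suc e)) ≡⟨ cong at (ℕP.+-comm (suc t) (x + suc e)) ⟩
          at (x + suc e + suc t)   ≡⟨ cong at (ℕP.+-assoc x (suc e) (suc t)) ⟩
          at (x + (suc e + suc t)) ≡⟨ cong (λ z → at (x + z)) (trans (ℕP.+-suc (suc e) t) 2+e+t≡L) ⟩
          at (x + L)               ≡⟨ periodic x ⟩
          at x                     ∎
          where open ≡-Reasoning

    neighbours⇒shorter : 2 ≤ k → ∀ {v} → Off C v → ∀ {x y} → x < L → y < L → x ≢ y
      → E v (at x) → E v (at y) → Shorter C
    neighbours⇒shorter 2≤k {v} off {x} {y} x<L y<L x≢y vx vy with ℕP.<-cmp x y
    ... | tri≈ _ x≡y _ = ⊥-elim (x≢y x≡y)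
    ... | tri< x<y _ _ with ≤⇒∃+ x<y
    ...   | e , refl = ordered-neighbours⇒shorter 2≤k off x e (subst (_< L) (≡-sym (ℕP.+-suc x e)) y<L)
                         vx (subst (E v ∘ at) (≡-sym (ℕP.+-suc x e)) vy)
    neighbours⇒shorter 2≤k {v} off {x} {y} x<L y<L x≢y vx vy | tri> _ _ y<x with ≤⇒∃+ y<x
    ...   | e , refl = ordered-neighbours⇒shorter 2≤k off y e (subst (_< L) (≡-sym (ℕP.+-suc y e)) x<L)
                         vy (subst (E v ∘ at) (≡-sym (ℕP.+-suc y e)) vx)

    spanning-chordless⇒iso : Chordless C → (∀ v → OnCycle C v) → IsoTo G (cycleG L)
    spanning-chordless⇒iso chordless spanning = surjective-copy⇒iso G (cycleG L)
      (f , (λ eq → FP.toℕ-injective (injective (FP.toℕ<n _) (FP.toℕ<n _) eq)) , f-adj) f-surjective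
      where
      f : Fin L → Fin n
      f = at ∘ toℕ
      f-adj : ∀ i j → cycleG L i j ≡ adj G (f i) (f j)
      f-adj i j = chordless⇒cycle-induced C chordless (FP.toℕ<n i) (FP.toℕ<n j)
      f-surjective : ∀ v → ∃ λ i → f i ≡ v
      f-surjective v with spanning v
      ... | x , x<L , refl = fromℕ< x<L , cong at (FP.toℕ-fromℕ< x<L)

    module Pendant (chordless : Chordless C) {v} (off : Off C v) (v0 : E v (at 0))
                   (unique : ∀ {y} → y < L → E v (at y) → y ≡ 0) where

      g : ℕ → Fin n
      g a with a ℕ.<? L
      ... | yes _ = at a
      ... | no _  = v

      g-below : ∀ {a} → a < L → g a ≡ at a
      g-below {a} a<L with a ℕ.<? L
      ... | yes _   = refl
      ... | no a≮L = contradiction a<L a≮L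

      g-L : g L ≡ v
      g-L with L ℕ.<? L
      ... | yes L<L = contradiction L<L (ℕP.<-irrefl refl)
      ... | no _    = refl

      Position : ℕ → Set
      Position a = (a < L × g a ≡ at a) ⊎ (a ≡ L × g a ≡ v)

      position : ∀ {a} → a ≤ L → Position a
      position a≤L with ℕP.m≤n⇒m<n∨m≡n a≤L
      ... | inj₁ a<L  = inj₁ (a<L , g-below a<L)
      ... | inj₂ refl = inj₂ (refl , g-L)

      g-injective : ∀ {a b} → a ≤ L → b ≤ L → g a ≡ g b → a ≡ b
      g-injective a≤L b≤L eq with position a≤L | position b≤L
      ... | inj₁ (a<L , ga) | inj₁ (b<L , gb) = injective a<L b<L (trans (≡-sym ga) (trans eq gb))
      ... | inj₁ (_ , ga)   | inj₂ (_ , gb)   = ⊥-elim (off _ (trans (≡-sym ga) (trans eq gb)))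
      ... | inj₂ (_ , ga)   | inj₁ (_ , gb)   = ⊥-elim (off _ (trans (≡-sym gb) (trans (≡-sym eq) ga)))
      ... | inj₂ (a≡L , _)  | inj₂ (b≡L , _)  = trans a≡L (≡-sym b≡L)

      g-edge⇒adjacent : ∀ {a b} → a ≤ L → b ≤ L → E (g a) (g b) → CyclePlusAdjacent L a b
      g-edge⇒adjacent a≤L b≤L ab with position a≤L | position b≤L
      ... | inj₁ (a<L , ga) | inj₁ (b<L , gb) =
        inj₁ (a<L , b<L , chordless a<L b<L (subst₂ E ga gb ab))
      ... | inj₁ (a<L , ga) | inj₂ (b≡L , gb) =
        inj₂ (inj₂ (b≡L , unique a<L (edge-sym G (subst₂ E ga gb ab))))
      ... | inj₂ (a≡L , ga) | inj₁ (b<L , gb) = inj₂ (inj₁ (a≡L , unique b<L (subst₂ E ga gb ab)))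
      ... | inj₂ (_ , ga)   | inj₂ (_ , gb)   = ⊥-elim (edge⇒≢ G (subst₂ E ga gb ab) refl)

      adjacent⇒g-edge : ∀ {a b} → CyclePlusAdjacent L a b → E (g a) (g b)
      adjacent⇒g-edge (inj₁ xy@(a<L , b<L , _)) =
        subst₂ E (≡-sym (g-below a<L)) (≡-sym (g-below b<L)) (cycle-adjacent⇒edge C xy)
      adjacent⇒g-edge (inj₂ (inj₁ (refl , refl))) = subst₂ E (≡-sym g-L) (≡-sym (g-below (s≤s z≤n))) v0
      adjacent⇒g-edge (inj₂ (inj₂ (refl , refl))) =
        subst₂ E (≡-sym (g-below (s≤s z≤n))) (≡-sym g-L) (edge-sym G v0)

      cyclePlus-copy : InducedCopy G (cyclePlus L)
      cyclePlus-copy = g ∘ toℕ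
        , (λ eq → FP.toℕ-injective (g-injective (bound _) (bound _) eq))
        , λ i j → does≡adj G (cyclePlusAdjacent? L (toℕ i) (toℕ j))
                    (g-edge⇒adjacent (bound i) (bound j)) adjacent⇒g-edge
        where
        bound : ∀ (i : Fin (suc L)) → toℕ i ≤ L
        bound i = ℕ.s≤s⁻¹ (FP.toℕ<n i)

  cycle-length≥5 : TriangleFree G → SquareFree G → (C : Cycle) → 2 ≤ Cycle.k C
  cycle-length≥5 no-triangle _ record { k = zero ; at = at ; periodic = periodic ; step = step } =
    ⊥-elim (no-triangle (step 0) (step 1) (subst (E (at 2)) (periodic 0) (step 2)))
  cycle-length≥5 _ no-square record { k = 1 ; at = at ; periodic = periodic ; step = step ; injective = injective } =
    ⊥-elim (no-square (step 0) (step 1) (step 2) (subst (E (at 3)) (periodic 0) (step 3))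
      (λ eq → contradiction (injective (s≤s z≤n) (s≤s (s≤s (s≤s z≤n))) eq) λ ())
      (λ eq → contradiction (injective (s≤s (s≤s z≤n)) (s≤s (s≤s (s≤s (s≤s z≤n)))) eq) λ ()))
  cycle-length≥5 _ _ record { k = suc (suc _) } = s≤s (s≤s z≤n)

  module Descent (conn : Connected G) (no-C⁺ : CyclePlusFree G)
                 (no-triangle : TriangleFree G) (no-square : SquareFree G) where

    CycleGraph : Set
    CycleGraph = Σ ℕ λ L → 3 ≤ L × IsoTo G (cycleG L)

    attached⇒cycle-graph : (C : Cycle) → (Shorter C → CycleGraph)
      → ∀ {v} → Off C v → E v (Cycle.at C 0) → CycleGraph
    attached⇒cycle-graph C recurse {v} off v0 with chord? C
    ... | yes chord = recurse (chord⇒shorter C chord)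
    ... | no ¬chord with ℕP.anyUpTo? (λ y → ¬? (y ℕ.≟ 0) ×-dec edge? G v (Cycle.at C y)) (length C)
    ...   | yes (y , y<L , y≢0 , vy) = recurse (neighbours⇒shorter C
            (cycle-length≥5 no-triangle no-square C) off (s≤s z≤n) y<L (y≢0 ∘ ≡-sym) v0 vy)
    ...   | no ¬second = ⊥-elim (no-C⁺ (length C) (s≤s (s≤s (s≤s z≤n)))
            (Pendant.cyclePlus-copy C (¬chord⇒chordless C ¬chord) off v0 unique))
      where
      unique : ∀ {y} → y < length C → E v (Cycle.at C y) → y ≡ 0
      unique {y} y<L vy with y ℕ.≟ 0
      ... | yes y≡0 = y≡0
      ... | no y≢0  = ⊥-elim (¬second (y , y<L , y≢0 , vy))

    cycle⇒cycle-graph : Cycle → CycleGraph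
    cycle⇒cycle-graph = All.wfRec (On.wellFounded Cycle.k <-wellFounded) _ (λ _ → CycleGraph) step
      where
      step : ∀ C → (∀ {C′} → Cycle.k C′ < Cycle.k C → CycleGraph) → CycleGraph
      step C ih with attached? C | chord? C
      ... | yes (v , ¬on , x , _ , vx) | _ =
        attached⇒cycle-graph (rotate C x) recurse (λ z → ¬onCycle⇒off C ¬on (z + x)) vx
        where
        recurse : Shorter (rotate C x) → CycleGraph
        recurse (C′ , shorter) = ih {C′} shorter
      ... | no _ | yes chord with chord⇒shorter C chord
      ...   | C′ , shorter = ih {C′} shorter
      step C ih | no ¬attached | no ¬chord = length C , s≤s (s≤s (s≤s z≤n)) ,
        spanning-chordless⇒iso C (¬chord⇒chordless C ¬chord) (unattached⇒spanning C conn ¬attached)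

  CycleIn⇒Cycle : CycleIn G → Cycle
  CycleIn⇒Cycle cy = cycle-from-path m p path-step closing p-injective
    where
    open CycleIn cy
    L = 3 + m
    p : ℕ → Fin n
    p x = c (fromℕ< (m%n<n x L))
    toℕ-position : ∀ x → toℕ (fromℕ< (m%n<n x L)) ≡ x % L
    toℕ-position x = FP.toℕ-fromℕ< (m%n<n x L)
    p≡c : ∀ {x} (i : Fin L) → x < L → toℕ i ≡ x → p x ≡ c i
    p≡c {x} i x<L i≡x = cong c (FP.toℕ-injective (trans (toℕ-position x) (trans (m<n⇒m%n≡m x<L) (≡-sym i≡x))))
    path-step : ∀ {x} → suc x < L → E (p x) (p (suc x))
    path-step {x} (s≤s x<2+m) = subst₂ E
      (≡-sym (p≡c (F.inject₁ i) (ℕP.m<n⇒m<1+n x<2+m) (trans (FP.toℕ-inject₁ i) (FP.toℕ-fromℕ< x<2+m))))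
      (≡-sym (p≡c (F.suc i) (s≤s x<2+m) (cong suc (FP.toℕ-fromℕ< x<2+m))))
      (c-step i)
      where i = fromℕ< x<2+m
    closing : E (p (2 + m)) (p 0)
    closing = subst₂ E (≡-sym (p≡c (F.fromℕ (2 + m)) ℕP.≤-refl (FP.toℕ-fromℕ (2 + m))))
                       (≡-sym (p≡c F.zero (s≤s z≤n) refl)) c-close
    p-injective : ∀ {x y} → x < L → y < L → p x ≡ p y → x ≡ y
    p-injective {x} {y} x<L y<L eq = begin
      x                             ≡⟨ ≡-sym (m<n⇒m%n≡m x<L) ⟩
      x % L                         ≡⟨ ≡-sym (toℕ-position x) ⟩
      toℕ (fromℕ< (m%n<n x L))      ≡⟨ cong toℕ (c-inj eq) ⟩
      toℕ (fromℕ< (m%n<n y L))      ≡⟨ toℕ-position y ⟩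
      y % L                         ≡⟨ m<n⇒m%n≡m y<L ⟩
      y                             ∎
      where open ≡-Reasoning

  cycle? : Dec (CycleIn G)
  cycle? = Dec.map′ from to (ℕP.anyUpTo? (λ m → ∃-function? (IsCycle m) IsCycle-resp (isCycle? m)) n)
    where
    IsCycle : ∀ m → (Fin (3 + m) → Fin n) → Set
    IsCycle m c = (∀ i j → c i ≡ c j → i ≡ j)
                × (∀ i → E (c (F.inject₁ i)) (c (F.suc i))) × E (c (F.fromℕ (2 + m))) (c F.zero)
    isCycle? : ∀ m c → Dec (IsCycle m c)
    isCycle? m c = FP.all? (λ i → FP.all? λ j → (c i F.≟ c j) →-dec (i F.≟ j))
                   ×-dec FP.all? (λ i → edge? G (c (F.inject₁ i)) (c (F.suc i)))
                   ×-dec edge? G (c (F.fromℕ (2 + m))) (c F.zero)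
    IsCycle-resp : ∀ {m c c′} → (∀ i → c i ≡ c′ i) → IsCycle m c → IsCycle m c′
    IsCycle-resp c≗c′ (inj , steps , close) =
      (λ i j eq → inj i j (trans (c≗c′ i) (trans eq (≡-sym (c≗c′ j))))) ,
      (λ i → subst₂ E (c≗c′ _) (c≗c′ _) (steps i)) ,
      subst₂ E (c≗c′ _) (c≗c′ _) close
    from : (∃ λ m → m < n × ∃ (IsCycle m)) → CycleIn G
    from (m , _ , c , inj , steps , close) = record
      { m = m ; c = c ; c-inj = inj _ _ ; c-step = steps ; c-close = close }
    to : CycleIn G → ∃ λ m → m < n × ∃ (IsCycle m)
    to cy = m , m<n , c , (λ _ _ → c-inj) , c-step , c-close
      where
      open CycleIn cy
      m<n : m < n
      m<n = ℕP.<-≤-trans (ℕP.m<n+m m {3} (s≤s z≤n)) (FP.injective⇒≤ c-inj)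

-- The classification

module _ {n : ℕ} (G : Graph n) where

  Triangle : Set
  Triangle = Σ (Fin n) λ a → Σ (Fin n) λ b → Σ (Fin n) λ c → Edge G a b × Edge G b c × Edge G c a

  triangle? : Dec Triangle
  triangle? = FP.any? λ a → FP.any? λ b → FP.any? λ c →
    edge? G a b ×-dec edge? G b c ×-dec edge? G c a

  Square : Set
  Square = Σ (Fin n) λ a → Σ (Fin n) λ b → Σ (Fin n) λ c → Σ (Fin n) λ d →
    Edge G a b × Edge G b c × Edge G c d × Edge G d a × a ≢ c × b ≢ d

  square? : Dec Square
  square? = FP.any? λ a → FP.any? λ b → FP.any? λ c → FP.any? λ d →
    edge? G a b ×-dec edge? G b c ×-dec edge? G c d ×-dec edge? G d a ×-dec ¬? (a F.≟ c) ×-dec ¬? (b F.≟ d)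

  Classification : Set
  Classification = IsTree G
    ⊎ (Σ ℕ λ k → 3 ≤ k × IsoTo G (cycleG k))
    ⊎ (Σ ℕ λ k → 4 ≤ k × IsoTo G (completeG k))
    ⊎ (Σ ℕ λ p → Σ ℕ λ q → 2 ≤ p × 2 ≤ q × IsoTo G (bipartiteG p q))

  classify : Connected G → CyclePlusFree G → ConeFree G → Classification
  classify conn no-C⁺ no-cone with triangle?
  ... | yes (_ , _ , _ , ab , bc , ca) = inj₂ ([ inj₁ , inj₂ ∘ inj₁ ]′
    (Triangles.connected-triangle⇒cycle-or-complete G no-C⁺ no-cone conn ab bc ca))
  ... | no ¬triangle with square?
  ...   | yes (_ , _ , _ , _ , ab , bc , cd , da , a≢c , b≢d) = inj₂ (inj₂ (inj₂
    (Squares.connected-square⇒complete-bipartite G no-C⁺ no-triangle conn ab bc cd da a≢c b≢d)))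
    where
    no-triangle : TriangleFree G
    no-triangle ab bc ca = ¬triangle (_ , _ , _ , ab , bc , ca)
  ...   | no ¬square with Cycles.cycle? G
  ...     | yes cycle = inj₂ (inj₁ (Cycles.Descent.cycle⇒cycle-graph G conn no-C⁺ no-triangle no-square
    (Cycles.CycleIn⇒Cycle G cycle)))
    where
    no-triangle : TriangleFree G
    no-triangle ab bc ca = ¬triangle (_ , _ , _ , ab , bc , ca)
    no-square : SquareFree G
    no-square ab bc cd da a≢c b≢d = ¬square (_ , _ , _ , _ , ab , bc , cd , da , a≢c , b≢d)
  ...     | no acyclic = inj₁ (conn , acyclic)

theorem3p6 : (n : ℕ) (G : Graph n) → 1 ≤ n → Connected G
    → (∀ k → 3 ≤ k → ¬ IsoTo G (cyclePlus k))
    → ¬ IsoTo G coneA3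
    → (∀ k → 3 ≤ k → ¬ HasProperInduced G (cyclePlus k))
    → ¬ HasProperInduced G coneA3
    → IsTree G
      ⊎ (Σ ℕ λ k → 3 ≤ k × IsoTo G (cycleG k))
      ⊎ (Σ ℕ λ k → 4 ≤ k × IsoTo G (completeG k))
      ⊎ (Σ ℕ λ p → Σ ℕ λ q → 2 ≤ p × 2 ≤ q × IsoTo G (bipartiteG p q))
theorem3p6 n G _ conn iso-C⁺ iso-cone proper-C⁺ proper-cone =
  classify G conn (λ k 3≤k → no-induced-copy G (cyclePlus k) (proper-C⁺ k 3≤k) (iso-C⁺ k 3≤k))
                  (no-induced-copy G coneA3 proper-cone iso-cone)
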